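{- Let $N$ and $M$ be well-formed labeled portnets and let $(M,\phi)$ be a partial mirror of $N$. Let $S=\textit{compose}(\{N,M\})$ with initial marking $i_S=i_N+i_M$ and final marking $f_S=f_N+f_M$. For all reachable markings $m_0,\dots,m_n,m_0'$, all transitions $t_1,\dots,t_n\in T_N$ with $\lambda(t_i)=\textit{receive}$, and every $u\in T_M$ with $\lambda(u)=\textit{send}$, such that $m_0\xrightarrow{t_1}\cdots\xrightarrow{t_n}m_n$ and $m_0\xrightarrow{u}m_0'$, there are markings $m_1',\dots,m_n'$ such that $m_0'\xrightarrow{t_1}\cdots\xrightarrow{t_n}m_n'$ and $m_n\xrightarrow{u}m_n'$.
   Context: Petri nets. Labeled Petri net $(P,T,F,\mathcal{L},\mu)$; ${}^\bullet x=\{y\mid (y,x)\in F\}$, $x^\bullet=\{y\mid (x,y)\in F\}$; markings $m:P\to\mathbb{N}$; $t$ enabled at $m$ iff ${}^\bullet t\le m$, firing gives $m-{}^\bullet t+t^\bullet$, written $m\xrightarrow{t}m'$. Reachable means reachable from $i_S$. A path is a sequence of nodes with consecutive pairs in $F$. OPNs. $N=(P,I,O,T,F,\textit{init},\textit{fin},\mathcal{L},\mu)$, $P,I,O$ pairwise disjoint, $(P\cup I\cup O,T,F,\mathcal{L},\mu)$ labeled Petri net, ${}^\bullet x=\emptyset$ for $x\in I$, $x^\bullet=\emptyset$ for $x\in O$, each $t$ has ${}^\bullet t\cap I=\emptyset$ or $t^\bullet\cap O=\emptyset$, $\textit{init},\textit{fin}\subseteq P$. $\lambda(t)=\textit{send}$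 if $t^\bullet\cap O\ne\emptyset$, $\textit{receive}$ if ${}^\bullet t\cap I\ne\emptyset$, else $\tau$. Skeleton: net on $P,T$ with arcs $F\cap((P\times T)\cup(T\times P))$. Labeled portnet: OPN whose skeleton has each transition with at most one input and one output place and is a workflow net (unique place $i$ with empty preset, unique $f$ with empty postset, all nodes on a path from $i$ to $f$), $\textit{init}=\{i\}$, $\textit{fin}=\{f\}$ (written $i_N,f_N$); each transition connected to exactly one interface place; transitions sharing an interface place share a label; equally labeled transitions are connected to the same interface place(s). Composition: $N,M$ composable iff shared nodes are exactly $(I_N\cup O_N)\cap(I_M\cup O_M)$ and, if $(I_N\cap O_M)\cup(I_M\cap O_N)\ne\emptyset$, then $O_N\subseteq I_M$, $O_M\subseteq I_N$, $I_N\cap I_M=O_N\cap O_M=\emptyset$. $\textit{compose}$: places $\bigcup P\cup(\bigcup I\cap\bigcup O)$, inputs $\bigcup I\setminus\bigcup O$, outputs $\bigcup O\setminus\bigcup I$, other components unions. Partial mirror of $N$: $(M,\phi)$, $M$ a labeled portnet, $\phi$ injective from nodes of $M$ to nodes of $N$ with $\phi(P_M)\subseteq P_N$, $\phi(T_M)\subseteq T_N$, $\phi(I_M)\subseteq O_N$, $\phi(O_M)\subseteq I_N$; for $(x,y)\in F_M$: if $x\notin I_M,y\notin O_M$ then $(\phi(x),\phi(y))\in F_N$, if $x\in I_M$ or $y\in O_M$ then $(\phi(y),\phi(x))\in F_N$; $\phi(\textit{init}_M)=\textit{init}_N$, $\phi(\textit{fin}_M)=\textit{fin}_N$; $\mu_M(t)=\mu_N(\phi(t))$;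 for all $p\in P_M$, $t\in\phi(p)^\bullet$ with $\lambda(t)=\textit{send}$ there is $t'\in p^\bullet$ with $\phi(t')=t$. In $\textit{compose}(\{N,M\})$ each interface place $x$ of $M$ is the same place as $\phi(x)$, and $N,M$ share no other nodes. Directions of transitions of $N$ and $M$ are taken in $N$ and $M$ respectively. Well-formed labeled portnet: observable choices (distinct $t,t'\in p^\bullet$ have distinct labels); diamond property (for $p\in P$, $t,t'\in p^\bullet$ with $\lambda(t)\ne\lambda(t')$, for all $q\in t^\bullet\cap P$, $q'\in t'^\bullet\cap P$ there are $u\in q^\bullet$, $u'\in q'^\bullet$ with $u^\bullet\cap u'^\bullet\ne\emptyset$, $\mu(t)=\mu(u')$, $\mu(t')=\mu(u)$); loop property (for $p\in P$ and distinct $t,t'\in p^\bullet$ with $\lambda(t)=\lambda(t')$, every path $\langle p\rangle\circ\pi$ whose transitions are $\langle t\rangle\circ\sigma\circ\langle t''\rangle$ with $\mu(t'')=\mu(t')$ and no transition of $\sigma$ labeled $\mu(t')$ contains a transition of direction $\ne\lambda(t)$). -}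

module Defs where

open import Data.Nat using (ℕ; zero; suc; _+_; _∸_; _≤_)
open import Data.Fin using (Fin)
open import Data.Bool using (Bool; true; false; _∧_; _∨_; not; if_then_else_)
open import Data.List using (List; []; _∷_; _++_; [_]; allFin)
open import Data.Bool.ListAction using (any)
open import Data.List.Relation.Unary.All using (All)
open import Data.List.Relation.Unary.Any using (Any)
open import Data.List.Relation.Unary.Linked using (Linked)
open import Data.Product using (Σ; Σ-syntax; _×_; _,_)
open import Data.Sum using (_⊎_)
open import Relation.Binary.PropositionalEquality using (_≡_; _≢_)
open import Relation.Binary.Construct.Closure.ReflexiveTransitive using (Star)

-- All nets live in a common finite universe of node names  Fin n  (so
-- every net is finite, and "shared nodes" of two nets are literally the
-- same names).

data Dir : Set where
  send receive tau : Dir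

record OPN (L : Set) (n : ℕ) : Set where
  field
    isP isI isO isT : Fin n → Bool
    F               : Fin n → Fin n → Bool
    init fin        : Fin n → Bool
    μ               : Fin n → L

open OPN public

module _ {L : Set} {n : ℕ} (N : OPN L n) where

  isPlace : Fin n → Bool
  isPlace x = isP N x ∨ isI N x ∨ isO N x

  isNode : Fin n → Bool
  isNode x = isPlace x ∨ isT N x

  isIface : Fin n → Bool
  isIface x = isI N x ∨ isO N x

  record IsOPN : Set where
    field
      disjPI : ∀ x → (isP N x ∧ isI N x) ≡ false
      disjPO : ∀ x → (isP N x ∧ isO N x) ≡ false
      disjIO : ∀ x → (isI N x ∧ isO N x) ≡ false
      disjPlT : ∀ x → (isPlace x ∧ isT N x) ≡ false
      arcs : ∀ x y → F N x y ≡ true →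
             (isPlace x ≡ true × isT N y ≡ true) ⊎ (isT N x ≡ true × isPlace y ≡ true)
      presetI  : ∀ x y → isI N x ≡ true → F N y x ≡ false
      postsetO : ∀ x y → isO N x ≡ true → F N x y ≡ false
      sendOrReceive : ∀ t → isT N t ≡ true →
             (∀ x → isI N x ≡ true → F N x t ≡ false) ⊎ (∀ x → isO N x ≡ true → F N t x ≡ false)
      initP : ∀ x → init N x ≡ true → isP N x ≡ true
      finP  : ∀ x → fin N x ≡ true → isP N x ≡ true

  isSend : Fin n → Bool
  isSend t = any (λ x → isO N x ∧ F N t x) (allFin n)

  isReceive : Fin n → Bool
  isReceive t = any (λ x → isI N x ∧ F N x t) (allFin n)

  dir : Fin n → Dir
  dir t = if isSend t then send else (if isReceive t then receive else tau)

  skArc : Fin n → Fin n → Bool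
  skArc x y = F N x y ∧ ((isP N x ∧ isT N y) ∨ (isT N x ∧ isP N y))

  SkArc : Fin n → Fin n → Set
  SkArc x y = skArc x y ≡ true

  connected : Fin n → Fin n → Bool
  connected t x = F N x t ∨ F N t x

  record IsPortnet : Set where
    field
      opn : IsOPN
      skIn  : ∀ t p q → isT N t ≡ true → skArc p t ≡ true → skArc q t ≡ true → p ≡ q
      skOut : ∀ t p q → isT N t ≡ true → skArc t p ≡ true → skArc t q ≡ true → p ≡ q
      -- skeleton is a workflow net with source i and sink f
      i f : Fin n
      iP : isP N i ≡ true
      iPre : ∀ x → skArc x i ≡ false
      iUnique : ∀ p → isP N p ≡ true → (∀ x → skArc x p ≡ false) → p ≡ i
      fP : isP N f ≡ true
      fPost : ∀ x → skArc f x ≡ false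
      fUnique : ∀ p → isP N p ≡ true → (∀ x → skArc p x ≡ false) → p ≡ f
      onPath : ∀ x → (isP N x ∨ isT N x) ≡ true → Star SkArc i x × Star SkArc x f
      initI : ∀ x → init N x ≡ true → x ≡ i
      initIn : init N i ≡ true
      finF : ∀ x → fin N x ≡ true → x ≡ f
      finIn : fin N f ≡ true
      oneIface : ∀ t → isT N t ≡ true →
        Σ[ x ∈ Fin n ] (isIface x ≡ true × connected t x ≡ true ×
                        (∀ y → isIface y ≡ true → connected t y ≡ true → y ≡ x))
      sharedLabel : ∀ t t' x → isT N t ≡ true → isT N t' ≡ true → isIface x ≡ true →
        connected t x ≡ true → connected t' x ≡ true → μ N t ≡ μ N t'
      sameIface : ∀ t t' → isT N t ≡ true → isT N t' ≡ true → μ N t ≡ μ N t' →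
        ∀ x → isIface x ≡ true → connected t x ≡ connected t' x

  transitionsOf : List (Fin n) → List (Fin n)
  transitionsOf [] = []
  transitionsOf (x ∷ xs) = if isT N x then x ∷ transitionsOf xs else transitionsOf xs

  Arc : Fin n → Fin n → Set
  Arc x y = F N x y ≡ true

  record WellFormed : Set where
    field
      portnet : IsPortnet
      observable : ∀ p t t' → isP N p ≡ true → F N p t ≡ true → F N p t' ≡ true →
        t ≢ t' → μ N t ≢ μ N t'
      diamond : ∀ p t t' → isP N p ≡ true → F N p t ≡ true → F N p t' ≡ true →
        dir t ≢ dir t' →
        ∀ q q' → isP N q ≡ true → F N t q ≡ true → isP N q' ≡ true → F N t' q' ≡ true →
        Σ[ u ∈ Fin n ] Σ[ u' ∈ Fin n ]
          (F N q u ≡ true × F N q' u' ≡ true ×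
           (Σ[ r ∈ Fin n ] (F N u r ≡ true × F N u' r ≡ true)) ×
           μ N t ≡ μ N u' × μ N t' ≡ μ N u)
      loop : ∀ p t t' → isP N p ≡ true → F N p t ≡ true → F N p t' ≡ true →
        t ≢ t' → dir t ≡ dir t' →
        ∀ (π σ : List (Fin n)) (t'' : Fin n) →
        Linked Arc (p ∷ π) →
        transitionsOf π ≡ t ∷ (σ ++ [ t'' ]) →
        μ N t'' ≡ μ N t' →
        All (λ s → μ N s ≢ μ N t') σ →
        Any (λ s → dir s ≢ dir t) (t ∷ (σ ++ [ t'' ]))

record PartialMirror {L : Set} {n : ℕ} (N M : OPN L n) (φ : Fin n → Fin n) : Set where
  field
    portnetM : IsPortnet M
    inj : ∀ x y → isNode M x ≡ true → isNode M y ≡ true → φ x ≡ φ y → x ≡ y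
    mapP : ∀ x → isP M x ≡ true → isP N (φ x) ≡ true
    mapT : ∀ x → isT M x ≡ true → isT N (φ x) ≡ true
    mapI : ∀ x → isI M x ≡ true → isO N (φ x) ≡ true
    mapO : ∀ x → isO M x ≡ true → isI N (φ x) ≡ true
    arcInternal : ∀ x y → F M x y ≡ true → isI M x ≡ false → isO M y ≡ false →
      F N (φ x) (φ y) ≡ true
    arcIface : ∀ x y → F M x y ≡ true → (isI M x ≡ true ⊎ isO M y ≡ true) →
      F N (φ y) (φ x) ≡ true
    initFwd : ∀ x → init M x ≡ true → init N (φ x) ≡ true
    initBwd : ∀ y → init N y ≡ true → Σ[ x ∈ Fin n ] (init M x ≡ true × φ x ≡ y)
    finFwd : ∀ x → fin M x ≡ true → fin N (φ x) ≡ true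
    finBwd : ∀ y → fin N y ≡ true → Σ[ x ∈ Fin n ] (fin M x ≡ true × φ x ≡ y)
    label : ∀ t → isT M t ≡ true → μ M t ≡ μ N (φ t)
    sendReflected : ∀ p → isP M p ≡ true → ∀ t → F N (φ p) t ≡ true → dir N t ≡ send →
      Σ[ t' ∈ Fin n ] (F M p t' ≡ true × φ t' ≡ t)

-- Convention for compose({N,M}): each interface place x of M is the same
-- node as φ(x), and N and M share no other nodes.
record MirrorComposition {L : Set} {n : ℕ} (N M : OPN L n) (φ : Fin n → Fin n) : Set where
  field
    ifaceIdentified : ∀ x → isIface M x ≡ true → φ x ≡ x
    sharedOnlyIface : ∀ x → isNode N x ≡ true → isNode M x ≡ true → isIface M x ≡ true

compose : {L : Set} {n : ℕ} → OPN L n → OPN L n → OPN L n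
compose N M = record
  { isP  = λ x → isP N x ∨ isP M x ∨ ((isI N x ∨ isI M x) ∧ (isO N x ∨ isO M x))
  ; isI  = λ x → (isI N x ∨ isI M x) ∧ not (isO N x ∨ isO M x)
  ; isO  = λ x → (isO N x ∨ isO M x) ∧ not (isI N x ∨ isI M x)
  ; isT  = λ x → isT N x ∨ isT M x
  ; F    = λ x y → F N x y ∨ F M x y
  ; init = λ x → init N x ∨ init M x
  ; fin  = λ x → fin N x ∨ fin M x
  ; μ    = λ x → if isT N x then μ N x else μ M x
  }

Marking : ℕ → Set
Marking n = Fin n → ℕ

ind : Bool → ℕ
ind b = if b then 1 else 0

setMarking : {n : ℕ} → (Fin n → Bool) → Marking n
setMarking s x = ind (s x)

_⊕_ : {n : ℕ} → Marking n → Marking n → Marking n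
(m ⊕ m') x = m x + m' x

Step : {L : Set} {n : ℕ} → OPN L n → Marking n → Fin n → Marking n → Set
Step S m t m' =
  isT S t ≡ true ×
  (∀ p → ind (F S p t) ≤ m p) ×
  (∀ p → m' p ≡ (m p ∸ ind (F S p t)) + ind (F S t p))

data Run {L : Set} {n : ℕ} (S : OPN L n) : Marking n → List (Fin n) → List (Marking n) → Set where
  []  : ∀ {m} → Run S m [] []
  _∷_ : ∀ {m t m₁ ts ms} → Step S m t m₁ → Run S m₁ ts ms → Run S m (t ∷ ts) (m₁ ∷ ms)

final : {n : ℕ} → Marking n → List (Marking n) → Marking n
final m [] = m
final m (m₁ ∷ ms) = final m₁ ms

Reachable : {L : Set} {n : ℕ} → OPN L n → Marking n → Marking n → Set
Reachable S i m = Star (λ a b → Σ[ t ∈ _ ] Step S a t b) i m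

{-# OPTIONS --safe #-}
module Submission where

open import Defs
open import Data.Bool using (true; false; _∧_; _∨_)
open import Data.Bool.Properties
  using (∨-zeroʳ; ∧-conicalˡ; ∧-conicalʳ; ¬-not; not-¬; T-≡)
open import Data.Empty using (⊥; ⊥-elim)
open import Data.Fin using (Fin)
open import Data.List using (List; []; _∷_; allFin)
open import Data.List.Relation.Unary.All as All using (All; []; _∷_)
open import Data.List.Relation.Unary.Any using (satisfied)
open import Data.List.Relation.Unary.Any.Properties using (any⁻)
open import Data.Nat using (ℕ; _+_; _∸_; _≤_; z≤n)
open import Data.Nat.Properties using (+-∸-comm; ≤-trans; m≤m+n; +-commutativeSemigroup)
open import Algebra.Properties.CommutativeSemigroup +-commutativeSemigroup using (xy∙z≈xz∙y)
open import Data.Product using (Σ-syntax; ∃-syntax; _×_; _,_)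
open import Data.Sum as Sum using (_⊎_; inj₁; inj₂)
open import Function.Bundles using (module Equivalence)
open import Relation.Binary.PropositionalEquality
  using (_≡_; refl; sym; trans; cong; cong₂; subst; module ≡-Reasoning)
open import Relation.Nullary using (contradiction)

open Equivalence using (to; from)

-- A send transition u of M has no arc from an interface place of M (its
-- interface arc is an output, and outputs have empty postsets), so it
-- consumes only from places of M's skeleton.  A transition of N consumes
-- only from places of N.  As N and M share nothing but M's interface places,
-- u and every transition of N have disjoint presets in the composition, and
-- transitions with disjoint presets commute; u is pushed along the run one
-- step at a time.

∨-introˡ : ∀ {a b} → a ≡ true → a ∨ b ≡ true
∨-introˡ refl = refl

∨-introʳ : ∀ a {b} → b ≡ true → a ∨ b ≡ true
∨-introʳ a refl = ∨-zeroʳ a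

∨-true⁻ : ∀ a {b} → a ∨ b ≡ true → a ≡ true ⊎ b ≡ true
∨-true⁻ true  _ = inj₁ refl
∨-true⁻ false e = inj₂ e

not-both-true : ∀ {a b} → (a ≡ true → b ≡ true → ⊥) → a ≡ false ⊎ b ≡ false
not-both-true {false}         _ = inj₁ refl
not-both-true {true} {false}  _ = inj₂ refl
not-both-true {true} {true}   h = ⊥-elim (h refl refl)

∸-+-+-comm : ∀ {m a} b d → a ≤ m → m ∸ a + b + d ≡ m + d ∸ a + b
∸-+-+-comm {m} {a} b d a≤m = begin
  m ∸ a + b + d  ≡⟨ xy∙z≈xz∙y (m ∸ a) b d ⟩
  m ∸ a + d + b  ≡⟨ cong (_+ b) (+-∸-comm d a≤m) ⟨
  m + d ∸ a + b  ∎
  where open ≡-Reasoning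

≤-∸-+-of-disjoint : ∀ {m a c} d → a ≤ m → a ≡ 0 ⊎ c ≡ 0 → a ≤ m ∸ c + d
≤-∸-+-of-disjoint     d a≤m (inj₁ refl) = z≤n
≤-∸-+-of-disjoint {m} d a≤m (inj₂ refl) = ≤-trans a≤m (m≤m+n m d)

∸-+-∸-+-comm-of-disjoint : ∀ {m a c} b d → a ≤ m → c ≤ m → a ≡ 0 ⊎ c ≡ 0 →
  m ∸ a + b ∸ c + d ≡ m ∸ c + d ∸ a + b
∸-+-∸-+-comm-of-disjoint b d a≤m c≤m (inj₁ refl) = sym (∸-+-+-comm d b c≤m)
∸-+-∸-+-comm-of-disjoint b d a≤m c≤m (inj₂ refl) = ∸-+-+-comm b d a≤m

DisjointPresets : {L : Set} {n : ℕ} → OPN L n → Fin n → Fin n → Set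
DisjointPresets S t u = ∀ p → F S p t ≡ false ⊎ F S p u ≡ false

module _ {L : Set} {n : ℕ} {S : OPN L n} where

  Step-commute : ∀ {t u m m₁ m₂} → DisjointPresets S t u → Step S m t m₁ → Step S m u m₂ →
    Σ[ m₃ ∈ Marking n ] (Step S m₂ t m₃ × Step S m₁ u m₃)
  Step-commute {t} {u} {m} {m₁} {m₂} disjoint
               (t∈T , t-enabled , m₁-eq) (u∈T , u-enabled , m₂-eq) =
    m₃ , (t∈T , t-enabled-at-m₂ , λ _ → refl) , (u∈T , u-enabled-at-m₁ , m₃-eq)
    where
    open ≡-Reasoning
    pre post : Fin n → Fin n → ℕ
    pre  x p = ind (F S p x)
    post x p = ind (F S x p)

    pre-disjoint : ∀ p → pre t p ≡ 0 ⊎ pre u p ≡ 0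
    pre-disjoint p = Sum.map (cong ind) (cong ind) (disjoint p)

    m₃ : Marking n
    m₃ p = m₂ p ∸ pre t p + post t p

    t-enabled-at-m₂ : ∀ p → pre t p ≤ m₂ p
    t-enabled-at-m₂ p = subst (pre t p ≤_) (sym (m₂-eq p))
      (≤-∸-+-of-disjoint (post u p) (t-enabled p) (pre-disjoint p))

    u-enabled-at-m₁ : ∀ p → pre u p ≤ m₁ p
    u-enabled-at-m₁ p = subst (pre u p ≤_) (sym (m₁-eq p))
      (≤-∸-+-of-disjoint (post t p) (u-enabled p) (Sum.swap (pre-disjoint p)))

    m₃-eq : ∀ p → m₃ p ≡ m₁ p ∸ pre u p + post u p
    m₃-eq p = begin
      m₂ p ∸ pre t p + post t p
        ≡⟨ cong (λ k → k ∸ pre t p + post t p) (m₂-eq p) ⟩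
      m p ∸ pre u p + post u p ∸ pre t p + post t p
        ≡⟨ ∸-+-∸-+-comm-of-disjoint (post u p) (post t p) (u-enabled p) (t-enabled p)
             (Sum.swap (pre-disjoint p)) ⟩
      m p ∸ pre t p + post t p ∸ pre u p + post u p
        ≡⟨ cong (λ k → k ∸ pre u p + post u p) (m₁-eq p) ⟨
      m₁ p ∸ pre u p + post u p
        ∎

  Run-commute : ∀ {u m m' ts ms} → All (λ t → DisjointPresets S t u) ts →
    Run S m ts ms → Step S m u m' →
    Σ[ ms' ∈ List (Marking n) ] (Run S m' ts ms' × Step S (final m ms) u (final m' ms'))
  Run-commute []                   []             u-step = [] , [] , u-step
  Run-commute (disjoint ∷ disjoints) (t-step ∷ run) u-step =
    let m₁' , t-step' , u-step₁ = Step-commute disjoint t-step u-step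
        ms' , run' , u-step'     = Run-commute disjoints run u-step₁
    in m₁' ∷ ms' , t-step' ∷ run' , u-step'

module _ {L : Set} {n : ℕ} (K : OPN L n) where

  dir-send⇒isSend : ∀ t → dir K t ≡ send → isSend K t ≡ true
  dir-send⇒isSend t t-send with isSend K t | isReceive K t
  dir-send⇒isSend t _  | true  | _     = refl
  dir-send⇒isSend t () | false | true
  dir-send⇒isSend t () | false | false

  isSend⇒output : ∀ {t} → isSend K t ≡ true → ∃[ x ] (isO K x ≡ true × F K t x ≡ true)
  isSend⇒output t-send =
    let x , x-output = satisfied (any⁻ _ (allFin n) (from T-≡ t-send))
        x∈O∧arc      = to T-≡ x-output
    in x , ∧-conicalˡ _ _ x∈O∧arc , ∧-conicalʳ _ _ x∈O∧arc

module _ {L : Set} {n : ℕ} {K : OPN L n} (K-opn : IsOPN K) where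
  open IsOPN K-opn

  arc-source-isNode : ∀ {x y} → F K x y ≡ true → isNode K x ≡ true
  arc-source-isNode {x} {y} arc with arcs x y arc
  ... | inj₁ (x∈P , _) = ∨-introˡ x∈P
  ... | inj₂ (x∈T , _) = ∨-introʳ (isPlace K x) x∈T

  arc-target-isNode : ∀ {x y} → F K x y ≡ true → isNode K y ≡ true
  arc-target-isNode {x} {y} arc with arcs x y arc
  ... | inj₁ (_ , y∈T) = ∨-introʳ (isPlace K y) y∈T
  ... | inj₂ (_ , y∈P) = ∨-introˡ y∈P

  isIface⇒¬isT : ∀ {x} → isIface K x ≡ true → isT K x ≡ false
  isIface⇒¬isT {x} x∈IO =
    trans (cong (_∧ isT K x) (sym (∨-introʳ (isP K x) x∈IO))) (disjPlT x)

  send-consumes-no-input : ∀ {u x} → isT K u ≡ true → dir K u ≡ send → isI K x ≡ true →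
    F K x u ≡ false
  send-consumes-no-input {u} {x} u∈T u-send x∈I with sendOrReceive u u∈T
  ... | inj₁ no-input  = no-input x x∈I
  ... | inj₂ no-output =
    let y , y∈O , u→y = isSend⇒output K (dir-send⇒isSend K u u-send)
    in contradiction (no-output y y∈O) (not-¬ u→y)

module _ {L : Set} {n : ℕ} {N M : OPN L n} {φ : Fin n → Fin n}
         (comp : MirrorComposition N M φ) where
  open MirrorComposition comp

  M-iface⇒N-iface : PartialMirror N M φ → ∀ {x} → isIface M x ≡ true → isIface N x ≡ true
  M-iface⇒N-iface mirror {x} x∈IO =
    subst (λ y → isIface N y ≡ true) (ifaceIdentified x x∈IO)
      (φ-iface (∨-true⁻ (isI M x) x∈IO))
    where
    open PartialMirror mirror using (mapI; mapO)
    φ-iface : isI M x ≡ true ⊎ isO M x ≡ true → isIface N (φ x) ≡ true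
    φ-iface (inj₁ x∈I) = ∨-introʳ (isI N (φ x)) (mapI x x∈I)
    φ-iface (inj₂ x∈O) = ∨-introˡ (mapO x x∈O)

  N-transition-not-in-M : IsOPN N → PartialMirror N M φ →
    ∀ {x} → isT N x ≡ true → isNode M x ≡ false
  N-transition-not-in-M N-opn mirror {x} x∈T = ¬-not λ x∈M →
    let x∈IOₘ = sharedOnlyIface x (∨-introʳ (isPlace N x) x∈T) x∈M
    in not-¬ x∈T (isIface⇒¬isT N-opn (M-iface⇒N-iface mirror x∈IOₘ))

  M-transition-not-in-N : IsOPN M → ∀ {x} → isT M x ≡ true → isNode N x ≡ false
  M-transition-not-in-N M-opn {x} x∈T = ¬-not λ x∈N →
    not-¬ x∈T (isIface⇒¬isT M-opn (sharedOnlyIface x x∈N (∨-introʳ (isPlace M x) x∈T)))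

  composition-disjoint-presets : IsOPN N → IsOPN M → PartialMirror N M φ →
    ∀ {t u} → isT N t ≡ true → isT M u ≡ true → dir M u ≡ send →
    DisjointPresets (compose N M) t u
  composition-disjoint-presets N-opn M-opn mirror {t} {u} t∈T u∈T u-send p =
    Sum.map (λ p↛ₙt → cong₂ _∨_ p↛ₙt p↛ₘt) (λ p↛ₘu → cong₂ _∨_ p↛ₙu p↛ₘu)
      (not-both-true no-common-input)
    where
    p↛ₘt : F M p t ≡ false
    p↛ₘt = ¬-not λ arc →
      not-¬ (arc-target-isNode M-opn arc) (N-transition-not-in-M N-opn mirror t∈T)

    p↛ₙu : F N p u ≡ false
    p↛ₙu = ¬-not λ arc →
      not-¬ (arc-target-isNode N-opn arc) (M-transition-not-in-N M-opn u∈T)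

    no-common-input : F N p t ≡ true → F M p u ≡ true → ⊥
    no-common-input p→ₙt p→ₘu with ∨-true⁻ (isI M p)
      (sharedOnlyIface p (arc-source-isNode N-opn p→ₙt) (arc-source-isNode M-opn p→ₘu))
    ... | inj₁ p∈I = not-¬ p→ₘu (send-consumes-no-input M-opn u∈T u-send p∈I)
    ... | inj₂ p∈O = not-¬ p→ₘu (IsOPN.postsetO M-opn p u p∈O)

lemma5 : {L : Set} {n : ℕ} (N M : OPN L n) (φ : Fin n → Fin n) →
    WellFormed N → WellFormed M → PartialMirror N M φ → MirrorComposition N M φ →
    ∀ (m₀ : Marking n) (ts : List (Fin n)) (ms : List (Marking n))
      (u : Fin n) (m₀' : Marking n) →
    All (Reachable (compose N M) (setMarking (init N) ⊕ setMarking (init M))) (m₀ ∷ ms) →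
    Reachable (compose N M) (setMarking (init N) ⊕ setMarking (init M)) m₀' →
    All (λ t → isT N t ≡ true × dir N t ≡ receive) ts →
    isT M u ≡ true → dir M u ≡ send →
    Run (compose N M) m₀ ts ms →
    Step (compose N M) m₀ u m₀' →
    Σ[ ms' ∈ List (Marking n) ]
      (Run (compose N M) m₀' ts ms' × Step (compose N M) (final m₀ ms) u (final m₀' ms'))
lemma5 N M φ N-wf M-wf mirror comp m₀ ts ms u m₀' _ _ ts-in-N u∈T u-send run u-step =
  Run-commute (All.map (λ (t∈T , _) → disjoint-from-u t∈T) ts-in-N) run u-step
  where
  opn : ∀ {K : OPN _ _} → WellFormed K → IsOPN K
  opn wf = IsPortnet.opn (WellFormed.portnet wf)

  disjoint-from-u : ∀ {t} → isT N t ≡ true → DisjointPresets (compose N M) t u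
  disjoint-from-u t∈T =
    composition-disjoint-presets comp (opn N-wf) (opn M-wf) mirror t∈T u∈T u-send
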